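{- Let $F(z)=e^{\frac{(1+z)^2}{2}}\int_0^z e^{ -\frac{(1+t)^2}{2}}\,dt$. Then for all $n\ge0$, $[z^n]F(z)\in\frac{1}{n!}\cdot\mathbb N$, i.e. $n!\,[z^n]F(z)$ is a nonnegative integer.
   Context: $[z^n]F(z)$ denotes the coefficient of $z^n$ in the Taylor expansion of $F$ at $0$. -}

module Defs where

open import Data.Nat using (ℕ; zero; suc; _∸_; _!)
open import Data.Nat.Properties using (_!≢0)
open import Data.Integer using (+_)
open import Data.Rational using (ℚ; 0ℚ; 1ℚ; _+_; _*_; -_; _/_)

PS : Set
PS = ℕ → ℚ

sumTo : ℕ → (ℕ → ℚ) → ℚ
sumTo zero    f = f zero
sumTo (suc n) f = sumTo n f + f (suc n)

invFact : ℕ → ℚ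
invFact k = (+ 1 / (k !)) {{k !≢0}}

_⊛_ : PS → PS → PS
(f ⊛ g) n = sumTo n (λ i → f i * g (n ∸ i))

onePS : PS
onePS zero    = 1ℚ
onePS (suc _) = 0ℚ

negPS : PS → PS
negPS f n = - f n

powPS : PS → ℕ → PS
powPS g zero    = onePS
powPS g (suc k) = g ⊛ powPS g k

-- exp(g) = Σ_k g^k / k!, for g with zero constant term
-- (then g^k has valuation ≥ k, so [z^n] only involves k ≤ n).
expPS : PS → PS
expPS g n = sumTo n (λ k → invFact k * powPS g k n)

integPS : PS → PS
integPS f zero    = 0ℚ
integPS f (suc n) = f n * (+ 1 / suc n)

-- (1+z)^2/2 - 1/2 = z + z^2/2
halfShift : PS
halfShift 1 = 1ℚ
halfShift 2 = + 1 / 2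
halfShift _ = 0ℚ

-- F(z) = e^{(1+z)^2/2} ∫_0^z e^{-(1+t)^2/2} dt
--      = e^{z+z^2/2} ∫_0^z e^{-(t+t^2/2)} dt   (the constants e^{±1/2} cancel)
F : PS
F = expPS halfShift ⊛ integPS (expPS (negPS halfShift))

ℕtoℚ : ℕ → ℚ
ℕtoℚ m = + m / 1

-- Write h = z + z²/2, so that F = e^h ∫₀ᶻ e^{-h}. Since h′ = 1 + z, differentiating
-- e^{ch} = Σ (ch)^k / k! term by term gives (e^{ch})′ = c (1+z) e^{ch}. Hence (e^h e^{-h})′ = 0,
-- so e^h e^{-h} = 1, and F′ = (1+z) F + 1 with F(0) = 0. Comparing coefficients, aₙ = n! [zⁿ] F
-- satisfies a₀ = 0, a₁ = 1 and aₙ₊₂ = aₙ₊₁ + (n+1) aₙ, so every aₙ is a natural number.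

module Submission where

open import Defs
open import Data.Nat as ℕ using (ℕ; zero; suc; _!; _∸_; _≤_; _<_; z≤n)
import Data.Nat.Properties as ℕP
open import Data.Product using (∃; _,_)
open import Data.Integer as ℤ using (+_)
import Data.Integer.Properties as ℤP
import Data.Integer.Tactic.RingSolver as ℤSolver
open import Data.Rational using (ℚ; 0ℚ; 1ℚ; ½; _+_; _*_; -_; _/_; toℚᵘ)
import Data.Rational.Properties as ℚP
open import Data.Rational.Unnormalised as ℚᵘ using (mkℚᵘ; *≡*)
import Data.Rational.Unnormalised.Properties as ℚᵘP
open import Algebra.Bundles using (CommutativeMonoid)
import Algebra.Properties.CommutativeSemigroup as CommSemigroupProperties
open import Level using (0ℓ)
open import Relation.Binary.PropositionalEquality
open import Relation.Nullary.Decidable using (dec⇒maybe)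
open import Tactic.RingSolver using (solve-∀)
import Tactic.RingSolver.Core.AlmostCommutativeRing as ACR

open CommSemigroupProperties (CommutativeMonoid.commutativeSemigroup ℚP.*-1-commutativeMonoid)
  using (x∙yz≈y∙xz; xy∙z≈y∙xz)
open CommSemigroupProperties (CommutativeMonoid.commutativeSemigroup ℚP.+-0-commutativeMonoid)
  using (interchange)

-- The zero test lets the solver simplify constant products such as 0ℚ * x.
ℚ-ring : ACR.AlmostCommutativeRing 0ℓ 0ℓ
ℚ-ring = ACR.fromCommutativeRing ℚP.+-*-commutativeRing (λ q → dec⇒maybe (0ℚ ℚP.≟ q))

-- The embedding ℕ → ℚ

toℚᵘ-/ : ∀ i d → toℚᵘ (i / suc d) ℚᵘ.≃ mkℚᵘ i d
toℚᵘ-/ i d = ℚP.toℚᵘ-fromℚᵘ (mkℚᵘ i d)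

ℕtoℚ-suc : ∀ m → ℕtoℚ (suc m) ≡ 1ℚ + ℕtoℚ m
ℕtoℚ-suc m = ℚP.toℚᵘ-injective (begin
  toℚᵘ (ℕtoℚ (suc m))              ≈⟨ toℚᵘ-/ (+ suc m) 0 ⟩
  mkℚᵘ (+ suc m) 0                 ≈⟨ *≡* (cross (+ m)) ⟩
  mkℚᵘ (+ 1) 0 ℚᵘ.+ mkℚᵘ (+ m) 0   ≈⟨ ℚᵘP.+-cong (toℚᵘ-/ (+ 1) 0) (toℚᵘ-/ (+ m) 0) ⟨
  toℚᵘ 1ℚ ℚᵘ.+ toℚᵘ (ℕtoℚ m)        ≈⟨ ℚP.toℚᵘ-homo-+ 1ℚ (ℕtoℚ m) ⟨
  toℚᵘ (1ℚ + ℕtoℚ m)               ∎)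
  where
  open ℚᵘP.≃-Reasoning
  cross : ∀ x → (+ 1 ℤ.+ x) ℤ.* + 1 ≡ (+ 1 ℤ.* + 1 ℤ.+ x ℤ.* + 1) ℤ.* + 1
  cross = ℤSolver.solve-∀

ℕtoℚ-+ : ∀ m n → ℕtoℚ (m ℕ.+ n) ≡ ℕtoℚ m + ℕtoℚ n
ℕtoℚ-+ zero    n = sym (ℚP.+-identityˡ (ℕtoℚ n))
ℕtoℚ-+ (suc m) n = begin
  ℕtoℚ (suc (m ℕ.+ n))          ≡⟨ ℕtoℚ-suc (m ℕ.+ n) ⟩
  1ℚ + ℕtoℚ (m ℕ.+ n)           ≡⟨ cong (λ q → 1ℚ + q) (ℕtoℚ-+ m n) ⟩
  1ℚ + (ℕtoℚ m + ℕtoℚ n)        ≡⟨ ℚP.+-assoc 1ℚ (ℕtoℚ m) (ℕtoℚ n) ⟨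
  (1ℚ + ℕtoℚ m) + ℕtoℚ n        ≡⟨ cong (_+ ℕtoℚ n) (ℕtoℚ-suc m) ⟨
  ℕtoℚ (suc m) + ℕtoℚ n         ∎
  where open ≡-Reasoning

ℕtoℚ-* : ∀ m n → ℕtoℚ (m ℕ.* n) ≡ ℕtoℚ m * ℕtoℚ n
ℕtoℚ-* zero    n = sym (ℚP.*-zeroˡ (ℕtoℚ n))
ℕtoℚ-* (suc m) n = begin
  ℕtoℚ (n ℕ.+ m ℕ.* n)            ≡⟨ ℕtoℚ-+ n (m ℕ.* n) ⟩
  ℕtoℚ n + ℕtoℚ (m ℕ.* n)         ≡⟨ cong (λ q → ℕtoℚ n + q) (ℕtoℚ-* m n) ⟩
  ℕtoℚ n + ℕtoℚ m * ℕtoℚ n        ≡⟨ cong (_+ ℕtoℚ m * ℕtoℚ n) (ℚP.*-identityˡ (ℕtoℚ n)) ⟨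
  1ℚ * ℕtoℚ n + ℕtoℚ m * ℕtoℚ n   ≡⟨ ℚP.*-distribʳ-+ (ℕtoℚ n) 1ℚ (ℕtoℚ m) ⟨
  (1ℚ + ℕtoℚ m) * ℕtoℚ n          ≡⟨ cong (_* ℕtoℚ n) (ℕtoℚ-suc m) ⟨
  ℕtoℚ (suc m) * ℕtoℚ n           ∎
  where open ≡-Reasoning

ℕtoℚ*1/ : ∀ m d e .{{_ : ℕ.NonZero d}} .{{_ : ℕ.NonZero e}} →
          d ≡ m ℕ.* e → ℕtoℚ m * (+ 1 / d) ≡ + 1 / e
ℕtoℚ*1/ m (suc d) (suc e) d≡m*e = ℚP.toℚᵘ-injective (begin
  toℚᵘ (ℕtoℚ m * (+ 1 / suc d))           ≈⟨ ℚP.toℚᵘ-homo-* (ℕtoℚ m) (+ 1 / suc d) ⟩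
  toℚᵘ (ℕtoℚ m) ℚᵘ.* toℚᵘ (+ 1 / suc d)   ≈⟨ ℚᵘP.*-cong (toℚᵘ-/ (+ m) 0) (toℚᵘ-/ (+ 1) d) ⟩
  mkℚᵘ (+ m) 0 ℚᵘ.* mkℚᵘ (+ 1) d         ≈⟨ *≡* cross ⟩
  mkℚᵘ (+ 1) e                           ≈⟨ toℚᵘ-/ (+ 1) e ⟨
  toℚᵘ (+ 1 / suc e)                      ∎)
  where
  open ℚᵘP.≃-Reasoning
  reassoc : ∀ x y → (x ℤ.* + 1) ℤ.* y ≡ + 1 ℤ.* (x ℤ.* y)
  reassoc = ℤSolver.solve-∀
  cross : (+ m ℤ.* + 1) ℤ.* + suc e ≡ + 1 ℤ.* + (1 ℕ.* suc d)
  cross = trans (reassoc (+ m) (+ suc e)) (cong (+ 1 ℤ.*_) (sym (trans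
    (cong +_ (trans (ℕP.*-identityˡ (suc d)) d≡m*e)) (ℤP.pos-* m (suc e)))))

ℕtoℚ[1+n]*1/[1+n]≡1 : ∀ n → ℕtoℚ (suc n) * (+ 1 / suc n) ≡ 1ℚ
ℕtoℚ[1+n]*1/[1+n]≡1 n = ℕtoℚ*1/ (suc n) (suc n) 1 (sym (ℕP.*-identityʳ (suc n)))

ℕtoℚ[1+k]*invFact[1+k] : ∀ k → ℕtoℚ (suc k) * invFact (suc k) ≡ invFact k
ℕtoℚ[1+k]*invFact[1+k] k = ℕtoℚ*1/ (suc k) (suc k !) (k !) {{suc k ℕP.!≢0}} {{k ℕP.!≢0}} refl

ℕtoℚ[1+n]*-cancel : ∀ n x → ℕtoℚ (suc n) * x ≡ 0ℚ → x ≡ 0ℚ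
ℕtoℚ[1+n]*-cancel n x [1+n]x≡0 = begin
  x                                  ≡⟨ ℚP.*-identityˡ x ⟨
  1ℚ * x                             ≡⟨ cong (_* x) (ℕtoℚ[1+n]*1/[1+n]≡1 n) ⟨
  (ℕtoℚ (suc n) * r) * x             ≡⟨ cong (_* x) (ℚP.*-comm (ℕtoℚ (suc n)) r) ⟩
  (r * ℕtoℚ (suc n)) * x             ≡⟨ ℚP.*-assoc r (ℕtoℚ (suc n)) x ⟩
  r * (ℕtoℚ (suc n) * x)             ≡⟨ cong (r *_) [1+n]x≡0 ⟩
  r * 0ℚ                             ≡⟨ ℚP.*-zeroʳ r ⟩
  0ℚ                                 ∎
  where
  open ≡-Reasoning
  r = + 1 / suc n

-- Finite sums

sumTo-cong : ∀ n {f g : ℕ → ℚ} → (∀ i → i ≤ n → f i ≡ g i) → sumTo n f ≡ sumTo n g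
sumTo-cong zero    f≡g = f≡g 0 z≤n
sumTo-cong (suc n) f≡g =
  cong₂ _+_ (sumTo-cong n (λ i i≤n → f≡g i (ℕP.m≤n⇒m≤1+n i≤n))) (f≡g (suc n) ℕP.≤-refl)

sumTo-+ : ∀ n (f g : ℕ → ℚ) → sumTo n (λ i → f i + g i) ≡ sumTo n f + sumTo n g
sumTo-+ zero    f g = refl
sumTo-+ (suc n) f g =
  trans (cong (_+ (f (suc n) + g (suc n))) (sumTo-+ n f g))
        (interchange (sumTo n f) (sumTo n g) (f (suc n)) (g (suc n)))

*-distribˡ-sumTo : ∀ n c (f : ℕ → ℚ) → sumTo n (λ i → c * f i) ≡ c * sumTo n f
*-distribˡ-sumTo zero    c f = refl
*-distribˡ-sumTo (suc n) c f =
  trans (cong (_+ c * f (suc n)) (*-distribˡ-sumTo n c f))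
        (sym (ℚP.*-distribˡ-+ c (sumTo n f) (f (suc n))))

sumTo-suc : ∀ n (f : ℕ → ℚ) → sumTo (suc n) f ≡ f 0 + sumTo n (λ i → f (suc i))
sumTo-suc zero    f = refl
sumTo-suc (suc n) f = trans (cong (_+ f (suc (suc n))) (sumTo-suc n f)) (ℚP.+-assoc (f 0) _ _)

sumTo-zero : ∀ n (f : ℕ → ℚ) → (∀ i → f i ≡ 0ℚ) → sumTo n f ≡ 0ℚ
sumTo-zero zero    f f≡0 = f≡0 0
sumTo-zero (suc n) f f≡0 = cong₂ _+_ (sumTo-zero n f f≡0) (f≡0 (suc n))

-- Operations on power series

infixl 6 _⊞_
infixr 7 _·_
infixr 8 z·_ [1+z]·_ [z+z²/2]·_
infix 30 ∂_
infix 4 _vanishesBelow_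

_⊞_ : PS → PS → PS
(f ⊞ g) n = f n + g n

_·_ : ℚ → PS → PS
(c · f) n = c * f n

z·_ : PS → PS
(z· f) zero    = 0ℚ
(z· f) (suc n) = f n

[1+z]·_ : PS → PS
[1+z]· f = f ⊞ z· f

[z+z²/2]·_ : PS → PS
[z+z²/2]· f = z· f ⊞ ½ · z· z· f

∂_ : PS → PS
(∂ f) n = ℕtoℚ (suc n) * f (suc n)

_vanishesBelow_ : PS → ℕ → Set
f vanishesBelow k = ∀ i → i < k → f i ≡ 0ℚ

z·-cong : ∀ {f g} → f ≗ g → z· f ≗ z· g
z·-cong f≗g zero    = refl
z·-cong f≗g (suc n) = f≗g n

[1+z]·-cong : ∀ {f g} → f ≗ g → [1+z]· f ≗ [1+z]· g
[1+z]·-cong f≗g n = cong₂ _+_ (f≗g n) (z·-cong f≗g n)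

z·-· : ∀ c f → z· (c · f) ≗ c · z· f
z·-· c f zero    = sym (ℚP.*-zeroʳ c)
z·-· c f (suc n) = refl

z·-⊞ : ∀ f g → z· (f ⊞ g) ≗ z· f ⊞ z· g
z·-⊞ f g zero    = refl
z·-⊞ f g (suc n) = refl

[1+z]·-· : ∀ c f → [1+z]· (c · f) ≗ c · [1+z]· f
[1+z]·-· c f n =
  trans (cong (λ q → c * f n + q) (z·-· c f n)) (sym (ℚP.*-distribˡ-+ c (f n) ((z· f) n)))

∂-integPS : ∀ f → ∂ integPS f ≗ f
∂-integPS f n = begin
  ℕtoℚ (suc n) * (f n * r)   ≡⟨ x∙yz≈y∙xz (ℕtoℚ (suc n)) (f n) r ⟩
  f n * (ℕtoℚ (suc n) * r)   ≡⟨ cong (f n *_) (ℕtoℚ[1+n]*1/[1+n]≡1 n) ⟩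
  f n * 1ℚ                   ≡⟨ ℚP.*-identityʳ (f n) ⟩
  f n                        ∎
  where
  open ≡-Reasoning
  r = + 1 / suc n

-- The Cauchy product

⊛-cong : ∀ {f f′ g g′} → f ≗ f′ → g ≗ g′ → f ⊛ g ≗ f′ ⊛ g′
⊛-cong f≗f′ g≗g′ n = sumTo-cong n (λ i _ → cong₂ _*_ (f≗f′ i) (g≗g′ (n ∸ i)))

⊛-·ˡ : ∀ c f g → (c · f) ⊛ g ≗ c · (f ⊛ g)
⊛-·ˡ c f g n =
  trans (sumTo-cong n (λ i _ → ℚP.*-assoc c (f i) (g (n ∸ i)))) (*-distribˡ-sumTo n c _)

⊛-·ʳ : ∀ c f g → f ⊛ (c · g) ≗ c · (f ⊛ g)
⊛-·ʳ c f g n =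
  trans (sumTo-cong n (λ i _ → x∙yz≈y∙xz (f i) c (g (n ∸ i)))) (*-distribˡ-sumTo n c _)

⊛-distribʳ-⊞ : ∀ f g h → (f ⊞ g) ⊛ h ≗ f ⊛ h ⊞ g ⊛ h
⊛-distribʳ-⊞ f g h n =
  trans (sumTo-cong n (λ i _ → ℚP.*-distribʳ-+ (h (n ∸ i)) (f i) (g i))) (sumTo-+ n _ _)

⊛-distribˡ-⊞ : ∀ f g h → f ⊛ (g ⊞ h) ≗ f ⊛ g ⊞ f ⊛ h
⊛-distribˡ-⊞ f g h n =
  trans (sumTo-cong n (λ i _ → ℚP.*-distribˡ-+ (f i) (g (n ∸ i)) (h (n ∸ i)))) (sumTo-+ n _ _)

⊛-z·ˡ : ∀ f g → (z· f) ⊛ g ≗ z· (f ⊛ g)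
⊛-z·ˡ f g zero    = ℚP.*-zeroˡ (g 0)
⊛-z·ˡ f g (suc n) = begin
  sumTo (suc n) (λ i → (z· f) i * g (suc n ∸ i))   ≡⟨ sumTo-suc n _ ⟩
  0ℚ * g (suc n) + (f ⊛ g) n                        ≡⟨ cong (_+ (f ⊛ g) n) (ℚP.*-zeroˡ (g (suc n))) ⟩
  0ℚ + (f ⊛ g) n                                    ≡⟨ ℚP.+-identityˡ _ ⟩
  (f ⊛ g) n                                         ∎
  where open ≡-Reasoning

⊛-z·ʳ : ∀ f g → f ⊛ (z· g) ≗ z· (f ⊛ g)
⊛-z·ʳ f g zero    = ℚP.*-zeroʳ (f 0)
⊛-z·ʳ f g (suc n) = begin
  sumTo n (λ i → f i * (z· g) (suc n ∸ i)) + f (suc n) * (z· g) (suc n ∸ suc n)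
    ≡⟨ cong₂ _+_ (sumTo-cong n (λ i i≤n → cong (λ j → f i * (z· g) j) (ℕP.+-∸-assoc 1 i≤n)))
                 (trans (cong (λ j → f (suc n) * (z· g) j) (ℕP.n∸n≡0 n)) (ℚP.*-zeroʳ (f (suc n)))) ⟩
  (f ⊛ g) n + 0ℚ
    ≡⟨ ℚP.+-identityʳ _ ⟩
  (f ⊛ g) n ∎
  where open ≡-Reasoning

⊛-[1+z]·ˡ : ∀ f g → ([1+z]· f) ⊛ g ≗ [1+z]· (f ⊛ g)
⊛-[1+z]·ˡ f g n =
  trans (⊛-distribʳ-⊞ f (z· f) g n) (cong (λ q → (f ⊛ g) n + q) (⊛-z·ˡ f g n))

⊛-[1+z]·ʳ : ∀ f g → f ⊛ ([1+z]· g) ≗ [1+z]· (f ⊛ g)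
⊛-[1+z]·ʳ f g n =
  trans (⊛-distribˡ-⊞ f g (z· g) n) (cong (λ q → (f ⊛ g) n + q) (⊛-z·ʳ f g n))

∂-⊛ : ∀ f g → ∂ (f ⊛ g) ≗ ∂ f ⊛ g ⊞ f ⊛ ∂ g
∂-⊛ f g n = begin
  ℕtoℚ (suc n) * sumTo (suc n) T
    ≡⟨ *-distribˡ-sumTo (suc n) (ℕtoℚ (suc n)) T ⟨
  sumTo (suc n) (λ i → ℕtoℚ (suc n) * T i)
    ≡⟨ sumTo-cong (suc n) split ⟩
  sumTo (suc n) (λ i → ℕtoℚ i * T i + ℕtoℚ (suc n ∸ i) * T i)
    ≡⟨ sumTo-+ (suc n) _ _ ⟩
  sumTo (suc n) (λ i → ℕtoℚ i * T i) + sumTo (suc n) (λ i → ℕtoℚ (suc n ∸ i) * T i)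
    ≡⟨ cong₂ _+_ ∂f⊛g f⊛∂g ⟩
  (∂ f ⊛ g) n + (f ⊛ ∂ g) n ∎
  where
  open ≡-Reasoning
  T : ℕ → ℚ
  T i = f i * g (suc n ∸ i)

  split : ∀ i → i ≤ suc n → ℕtoℚ (suc n) * T i ≡ ℕtoℚ i * T i + ℕtoℚ (suc n ∸ i) * T i
  split i i≤1+n = begin
    ℕtoℚ (suc n) * T i                          ≡⟨ cong (λ k → ℕtoℚ k * T i) (ℕP.m+[n∸m]≡n i≤1+n) ⟨
    ℕtoℚ (i ℕ.+ (suc n ∸ i)) * T i              ≡⟨ cong (_* T i) (ℕtoℚ-+ i (suc n ∸ i)) ⟩
    (ℕtoℚ i + ℕtoℚ (suc n ∸ i)) * T i           ≡⟨ ℚP.*-distribʳ-+ (T i) (ℕtoℚ i) _ ⟩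
    ℕtoℚ i * T i + ℕtoℚ (suc n ∸ i) * T i       ∎

  ∂f⊛g : sumTo (suc n) (λ i → ℕtoℚ i * T i) ≡ (∂ f ⊛ g) n
  ∂f⊛g = begin
    sumTo (suc n) (λ i → ℕtoℚ i * T i)
      ≡⟨ sumTo-suc n _ ⟩
    0ℚ * T 0 + sumTo n (λ i → ℕtoℚ (suc i) * T (suc i))
      ≡⟨ cong (_+ sumTo n (λ i → ℕtoℚ (suc i) * T (suc i))) (ℚP.*-zeroˡ (T 0)) ⟩
    0ℚ + sumTo n (λ i → ℕtoℚ (suc i) * T (suc i))
      ≡⟨ ℚP.+-identityˡ _ ⟩
    sumTo n (λ i → ℕtoℚ (suc i) * T (suc i))
      ≡⟨ sumTo-cong n (λ i _ → ℚP.*-assoc (ℕtoℚ (suc i)) (f (suc i)) (g (n ∸ i))) ⟨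
    (∂ f ⊛ g) n ∎

  f⊛∂g : sumTo (suc n) (λ i → ℕtoℚ (suc n ∸ i) * T i) ≡ (f ⊛ ∂ g) n
  f⊛∂g = begin
    sumTo n (λ i → ℕtoℚ (suc n ∸ i) * T i) + ℕtoℚ (suc n ∸ suc n) * T (suc n)
      ≡⟨ cong₂ _+_ (sumTo-cong n inner) (trans (cong (λ k → ℕtoℚ k * T (suc n)) (ℕP.n∸n≡0 n))
                                               (ℚP.*-zeroˡ (T (suc n)))) ⟩
    (f ⊛ ∂ g) n + 0ℚ
      ≡⟨ ℚP.+-identityʳ _ ⟩
    (f ⊛ ∂ g) n ∎
    where
    inner : ∀ i → i ≤ n → ℕtoℚ (suc n ∸ i) * T i ≡ f i * (∂ g) (n ∸ i)
    inner i i≤n rewrite ℕP.+-∸-assoc 1 i≤n = x∙yz≈y∙xz (ℕtoℚ (suc (n ∸ i))) (f i) (g (suc (n ∸ i)))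

-- Multiplication by h = z + z²/2

halfShift-⊛ : ∀ f → halfShift ⊛ f ≗ [z+z²/2]· f
halfShift-⊛ f zero          = ℚP.*-zeroˡ (f 0)
halfShift-⊛ f (suc zero)    = first-two (f 0) (f 1)
  where
  first-two : ∀ a b → 0ℚ * b + 1ℚ * a ≡ a + ½ * 0ℚ
  first-two = solve-∀ ℚ-ring
halfShift-⊛ f (suc (suc n)) = begin
  sumTo (suc (suc n)) (λ i → halfShift i * f (suc (suc n) ∸ i))
    ≡⟨ sumTo-suc (suc n) _ ⟩
  0ℚ * f (suc (suc n)) + sumTo (suc n) (λ i → halfShift (suc i) * f (suc n ∸ i))
    ≡⟨ cong (λ q → 0ℚ * f (suc (suc n)) + q) (sumTo-suc n _) ⟩
  0ℚ * f (suc (suc n)) + (1ℚ * f (suc n) + sumTo n (λ i → halfShift (suc (suc i)) * f (n ∸ i)))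
    ≡⟨ cong (λ q → 0ℚ * f (suc (suc n)) + (1ℚ * f (suc n) + q)) (z²-part n) ⟩
  0ℚ * f (suc (suc n)) + (1ℚ * f (suc n) + ½ * f n)
    ≡⟨ collect (f (suc (suc n))) (f (suc n)) (f n) ⟩
  f (suc n) + ½ * f n ∎
  where
  open ≡-Reasoning
  collect : ∀ a b c → 0ℚ * a + (1ℚ * b + ½ * c) ≡ b + ½ * c
  collect = solve-∀ ℚ-ring
  z²-part : ∀ m → sumTo m (λ i → halfShift (suc (suc i)) * f (m ∸ i)) ≡ ½ * f m
  z²-part zero    = refl
  z²-part (suc m) = trans (sumTo-suc m _) (trans
    (cong (λ q → ½ * f (suc m) + q) (sumTo-zero m _ (λ i → ℚP.*-zeroˡ (f (m ∸ i)))))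
    (ℚP.+-identityʳ _))

[z+z²/2]·-cong : ∀ {f g} → f ≗ g → [z+z²/2]· f ≗ [z+z²/2]· g
[z+z²/2]·-cong f≗g n = cong₂ (λ a b → a + ½ * b) (z·-cong f≗g n) (z·-cong (z·-cong f≗g) n)

[z+z²/2]·-· : ∀ c f → [z+z²/2]· (c · f) ≗ c · [z+z²/2]· f
[z+z²/2]·-· c f n = trans
  (cong₂ (λ a b → a + ½ * b) (z·-· c f n) (trans (z·-cong (z·-· c f) n) (z·-· c (z· f) n)))
  (pull c ((z· f) n) ((z· z· f) n))
  where
  pull : ∀ c a b → c * a + ½ * (c * b) ≡ c * (a + ½ * b)
  pull = solve-∀ ℚ-ring

[z+z²/2]·-⊞ : ∀ f g → [z+z²/2]· (f ⊞ g) ≗ [z+z²/2]· f ⊞ [z+z²/2]· g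
[z+z²/2]·-⊞ f g n = trans
  (cong₂ (λ a b → a + ½ * b) (z·-⊞ f g n) (trans (z·-cong (z·-⊞ f g) n) (z·-⊞ (z· f) (z· g) n)))
  (distrib ((z· f) n) ((z· g) n) ((z· z· f) n) ((z· z· g) n))
  where
  distrib : ∀ a b c d → (a + b) + ½ * (c + d) ≡ (a + ½ * c) + (b + ½ * d)
  distrib = solve-∀ ℚ-ring

[z+z²/2]·-z· : ∀ f → [z+z²/2]· z· f ≗ z· [z+z²/2]· f
[z+z²/2]·-z· f zero    = refl
[z+z²/2]·-z· f (suc n) = refl

[z+z²/2]·-[1+z]· : ∀ f → [z+z²/2]· [1+z]· f ≗ [1+z]· [z+z²/2]· f
[z+z²/2]·-[1+z]· f n =
  trans ([z+z²/2]·-⊞ f (z· f) n) (cong (λ q → ([z+z²/2]· f) n + q) ([z+z²/2]·-z· f n))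

∂-[z+z²/2]· : ∀ f → ∂ ([z+z²/2]· f) ≗ [1+z]· f ⊞ [z+z²/2]· ∂ f
∂-[z+z²/2]· f zero          = coeff₀ (f 0)
  where
  coeff₀ : ∀ a → 1ℚ * (a + ½ * 0ℚ) ≡ (a + 0ℚ) + (0ℚ + ½ * 0ℚ)
  coeff₀ = solve-∀ ℚ-ring
∂-[z+z²/2]· f (suc zero)    = coeff₁ (f 0) (f 1)
  where
  coeff₁ : ∀ a b → ℕtoℚ 2 * (b + ½ * a) ≡ (b + a) + (1ℚ * b + ½ * 0ℚ)
  coeff₁ = solve-∀ ℚ-ring
∂-[z+z²/2]· f (suc (suc m)) = begin
  ℕtoℚ (3 ℕ.+ m) * (a + ½ * b)                  ≡⟨ cong (_* (a + ½ * b)) ℕtoℚ[3+m] ⟩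
  (1ℚ + (1ℚ + r)) * (a + ½ * b)                 ≡⟨ coeff r a b ⟩
  (a + b) + ((1ℚ + r) * a + ½ * (r * b))        ≡⟨ cong (λ s → (a + b) + (s * a + ½ * (r * b))) (ℕtoℚ-suc (suc m)) ⟨
  (a + b) + (ℕtoℚ (2 ℕ.+ m) * a + ½ * (r * b))  ∎
  where
  open ≡-Reasoning
  a = f (suc (suc m))
  b = f (suc m)
  r = ℕtoℚ (suc m)
  ℕtoℚ[3+m] : ℕtoℚ (3 ℕ.+ m) ≡ 1ℚ + (1ℚ + r)
  ℕtoℚ[3+m] = trans (ℕtoℚ-suc (2 ℕ.+ m)) (cong (λ q → 1ℚ + q) (ℕtoℚ-suc (suc m)))
  coeff : ∀ r a b → (1ℚ + (1ℚ + r)) * (a + ½ * b) ≡ (a + b) + ((1ℚ + r) * a + ½ * (r * b))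
  coeff = solve-∀ ℚ-ring

[z+z²/2]·-vanishesBelow : ∀ {f k} → f vanishesBelow k → [z+z²/2]· f vanishesBelow suc k
[z+z²/2]·-vanishesBelow f≡0 zero          _   = refl
[z+z²/2]·-vanishesBelow f≡0 (suc zero)    1<1+k = cong (λ q → q + ½ * 0ℚ) (f≡0 0 (ℕP.≤-pred 1<1+k))
[z+z²/2]·-vanishesBelow f≡0 (suc (suc n)) 2+n<1+k = cong₂ (λ a b → a + ½ * b)
  (f≡0 (suc n) 1+n<k) (f≡0 n (ℕP.<-trans (ℕP.n<1+n n) 1+n<k))
  where
  1+n<k = ℕP.≤-pred 2+n<1+k

-- The exponential

∂-expPS : ∀ g n → (∂ expPS g) n ≡ sumTo n (λ k → invFact (suc k) * (∂ powPS g (suc k)) n)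
∂-expPS g n = begin
  ℕtoℚ (suc n) * sumTo (suc n) (λ k → invFact k * P k (suc n))
    ≡⟨ *-distribˡ-sumTo (suc n) (ℕtoℚ (suc n)) _ ⟨
  sumTo (suc n) (λ k → ℕtoℚ (suc n) * (invFact k * P k (suc n)))
    ≡⟨ sumTo-cong (suc n) (λ k _ → x∙yz≈y∙xz (ℕtoℚ (suc n)) (invFact k) (P k (suc n))) ⟩
  sumTo (suc n) (λ k → invFact k * (∂ P k) n)
    ≡⟨ sumTo-suc n _ ⟩
  invFact 0 * (∂ onePS) n + sumTo n (λ k → invFact (suc k) * (∂ P (suc k)) n)
    ≡⟨ cong (_+ sumTo n (λ k → invFact (suc k) * (∂ P (suc k)) n))
            (trans (cong (invFact 0 *_) (ℚP.*-zeroʳ (ℕtoℚ (suc n)))) (ℚP.*-zeroʳ (invFact 0))) ⟩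
  0ℚ + sumTo n (λ k → invFact (suc k) * (∂ P (suc k)) n)
    ≡⟨ ℚP.+-identityˡ _ ⟩
  sumTo n (λ k → invFact (suc k) * (∂ P (suc k)) n) ∎
  where
  open ≡-Reasoning
  P = powPS g

module ExpOfMultipleOfHalfShift (g : PS) (c : ℚ) (g≗c·halfShift : g ≗ c · halfShift) where

  P : ℕ → PS
  P = powPS g

  E : PS
  E = expPS g

  P-suc : ∀ k → P (suc k) ≗ c · [z+z²/2]· P k
  P-suc k n = begin
    (g ⊛ P k) n                  ≡⟨ ⊛-cong {g = P k} g≗c·halfShift (λ _ → refl) n ⟩
    ((c · halfShift) ⊛ P k) n    ≡⟨ ⊛-·ˡ c halfShift (P k) n ⟩
    c * (halfShift ⊛ P k) n      ≡⟨ cong (c *_) (halfShift-⊛ (P k) n) ⟩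
    c * ([z+z²/2]· P k) n        ∎
    where open ≡-Reasoning

  P-vanishesBelow : ∀ k → P k vanishesBelow k
  P-vanishesBelow zero    n ()
  P-vanishesBelow (suc k) n n<1+k = trans (P-suc k n)
    (trans (cong (c *_) ([z+z²/2]·-vanishesBelow (P-vanishesBelow k) n n<1+k)) (ℚP.*-zeroʳ c))

  ∂-P-suc : ∀ k → ∂ P (suc k) ≗ (c * ℕtoℚ (suc k)) · [1+z]· P k
  [z+z²/2]·-∂-P : ∀ k → [z+z²/2]· ∂ P k ≗ ℕtoℚ k · [1+z]· P k

  ∂-P-suc k n = begin
    ℕtoℚ (suc n) * P (suc k) (suc n)
      ≡⟨ cong (ℕtoℚ (suc n) *_) (P-suc k (suc n)) ⟩
    ℕtoℚ (suc n) * (c * ([z+z²/2]· P k) (suc n))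
      ≡⟨ x∙yz≈y∙xz (ℕtoℚ (suc n)) c _ ⟩
    c * (∂ ([z+z²/2]· P k)) n
      ≡⟨ cong (c *_) (∂-[z+z²/2]· (P k) n) ⟩
    c * (([1+z]· P k) n + ([z+z²/2]· ∂ P k) n)
      ≡⟨ cong (λ q → c * (([1+z]· P k) n + q)) ([z+z²/2]·-∂-P k n) ⟩
    c * (([1+z]· P k) n + ℕtoℚ k * ([1+z]· P k) n)
      ≡⟨ collect c (ℕtoℚ k) (([1+z]· P k) n) ⟩
    (c * (1ℚ + ℕtoℚ k)) * ([1+z]· P k) n
      ≡⟨ cong (λ q → (c * q) * ([1+z]· P k) n) (ℕtoℚ-suc k) ⟨
    (c * ℕtoℚ (suc k)) * ([1+z]· P k) n ∎
    where
    open ≡-Reasoning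
    collect : ∀ c r x → c * (x + r * x) ≡ (c * (1ℚ + r)) * x
    collect = solve-∀ ℚ-ring

  [z+z²/2]·-∂-P zero    n = trans
    ([z+z²/2]·-vanishesBelow (λ i _ → ℚP.*-zeroʳ (ℕtoℚ (suc i))) n ℕP.≤-refl)
    (sym (ℚP.*-zeroˡ (([1+z]· P 0) n)))
  [z+z²/2]·-∂-P (suc k) n = begin
    ([z+z²/2]· ∂ P (suc k)) n
      ≡⟨ [z+z²/2]·-cong (∂-P-suc k) n ⟩
    ([z+z²/2]· (s · [1+z]· P k)) n
      ≡⟨ [z+z²/2]·-· s ([1+z]· P k) n ⟩
    s * ([z+z²/2]· [1+z]· P k) n
      ≡⟨ cong (s *_) ([z+z²/2]·-[1+z]· (P k) n) ⟩
    (c * ℕtoℚ (suc k)) * ([1+z]· [z+z²/2]· P k) n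
      ≡⟨ xy∙z≈y∙xz c (ℕtoℚ (suc k)) _ ⟩
    ℕtoℚ (suc k) * (c * ([1+z]· [z+z²/2]· P k) n)
      ≡⟨ cong (ℕtoℚ (suc k) *_) ([1+z]·-· c ([z+z²/2]· P k) n) ⟨
    ℕtoℚ (suc k) * ([1+z]· (c · [z+z²/2]· P k)) n
      ≡⟨ cong (ℕtoℚ (suc k) *_) ([1+z]·-cong (P-suc k) n) ⟨
    ℕtoℚ (suc k) * ([1+z]· P (suc k)) n ∎
    where
    open ≡-Reasoning
    s = c * ℕtoℚ (suc k)

  sumTo-z·P : ∀ n → sumTo n (λ k → invFact k * (z· P k) n) ≡ (z· E) n
  sumTo-z·P zero    = refl
  sumTo-z·P (suc m) = trans
    (cong (λ q → E m + q) (trans (cong (invFact (suc m) *_) (P-vanishesBelow (suc m) m ℕP.≤-refl))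
                                 (ℚP.*-zeroʳ (invFact (suc m)))))
    (ℚP.+-identityʳ (E m))

  ∂-E : ∂ E ≗ c · [1+z]· E
  ∂-E n = begin
    (∂ E) n
      ≡⟨ ∂-expPS g n ⟩
    sumTo n (λ k → invFact (suc k) * (∂ P (suc k)) n)
      ≡⟨ sumTo-cong n (λ k _ → term k) ⟩
    sumTo n (λ k → c * (invFact k * P k n + invFact k * (z· P k) n))
      ≡⟨ *-distribˡ-sumTo n c _ ⟩
    c * sumTo n (λ k → invFact k * P k n + invFact k * (z· P k) n)
      ≡⟨ cong (c *_) (sumTo-+ n _ _) ⟩
    c * (E n + sumTo n (λ k → invFact k * (z· P k) n))
      ≡⟨ cong (λ q → c * (E n + q)) (sumTo-z·P n) ⟩
    c * (E n + (z· E) n) ∎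
    where
    open ≡-Reasoning
    regroup : ∀ i c r x y → i * ((c * r) * (x + y)) ≡ c * ((r * i) * x + (r * i) * y)
    regroup = solve-∀ ℚ-ring
    term : ∀ k → invFact (suc k) * (∂ P (suc k)) n ≡ c * (invFact k * P k n + invFact k * (z· P k) n)
    term k = begin
      invFact (suc k) * (∂ P (suc k)) n
        ≡⟨ cong (invFact (suc k) *_) (∂-P-suc k n) ⟩
      invFact (suc k) * ((c * ℕtoℚ (suc k)) * (P k n + (z· P k) n))
        ≡⟨ regroup (invFact (suc k)) c (ℕtoℚ (suc k)) (P k n) ((z· P k) n) ⟩
      c * (ℕtoℚ (suc k) * invFact (suc k) * P k n + ℕtoℚ (suc k) * invFact (suc k) * (z· P k) n)
        ≡⟨ cong (λ q → c * (q * P k n + q * (z· P k) n)) (ℕtoℚ[1+k]*invFact[1+k] k) ⟩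
      c * (invFact k * P k n + invFact k * (z· P k) n) ∎

  ∂E-⊛ : ∀ h → ∂ E ⊛ h ≗ c · [1+z]· (E ⊛ h)
  ∂E-⊛ h n = trans (⊛-cong {g = h} ∂-E (λ _ → refl) n)
    (trans (⊛-·ˡ c ([1+z]· E) h n) (cong (c *_) (⊛-[1+z]·ˡ E h n)))

  ⊛-∂E : ∀ h → h ⊛ ∂ E ≗ c · [1+z]· (h ⊛ E)
  ⊛-∂E h n = trans (⊛-cong {f = h} (λ _ → refl) ∂-E n)
    (trans (⊛-·ʳ c h ([1+z]· E) n) (cong (c *_) (⊛-[1+z]·ʳ h E n)))

-- The coefficients of F

module E⁺ = ExpOfMultipleOfHalfShift halfShift 1ℚ (λ n → sym (ℚP.*-identityˡ (halfShift n)))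
module E⁻ = ExpOfMultipleOfHalfShift (negPS halfShift) (- 1ℚ)
  (λ n → trans (cong -_ (sym (ℚP.*-identityˡ (halfShift n)))) (ℚP.neg-distribˡ-* 1ℚ (halfShift n)))

E⁺⊛E⁻≗1 : E⁺.E ⊛ E⁻.E ≗ onePS
E⁺⊛E⁻≗1 zero    = refl
E⁺⊛E⁻≗1 (suc n) = ℕtoℚ[1+n]*-cancel n _ (begin
  (∂ (E⁺.E ⊛ E⁻.E)) n                          ≡⟨ ∂-⊛ E⁺.E E⁻.E n ⟩
  (∂ E⁺.E ⊛ E⁻.E) n + (E⁺.E ⊛ ∂ E⁻.E) n        ≡⟨ cong₂ _+_ (E⁺.∂E-⊛ E⁻.E n) (E⁻.⊛-∂E E⁺.E n) ⟩
  1ℚ * w + - 1ℚ * w                            ≡⟨ cancel w ⟩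
  0ℚ                                           ∎)
  where
  open ≡-Reasoning
  w = ([1+z]· (E⁺.E ⊛ E⁻.E)) n
  cancel : ∀ x → 1ℚ * x + - 1ℚ * x ≡ 0ℚ
  cancel = solve-∀ ℚ-ring

∂F : ∂ F ≗ [1+z]· F ⊞ onePS
∂F n = begin
  (∂ F) n                                                     ≡⟨ ∂-⊛ E⁺.E I n ⟩
  (∂ E⁺.E ⊛ I) n + (E⁺.E ⊛ ∂ I) n                             ≡⟨ cong₂ _+_ ∂E⁺⊛I E⁺⊛∂I ⟩
  ([1+z]· F) n + onePS n                                      ∎
  where
  open ≡-Reasoning
  I = integPS E⁻.E
  ∂E⁺⊛I : (∂ E⁺.E ⊛ I) n ≡ ([1+z]· F) n
  ∂E⁺⊛I = trans (E⁺.∂E-⊛ I n) (ℚP.*-identityˡ _)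
  E⁺⊛∂I : (E⁺.E ⊛ ∂ I) n ≡ onePS n
  E⁺⊛∂I = trans (⊛-cong {f = E⁺.E} (λ _ → refl) (∂-integPS E⁻.E) n) (E⁺⊛E⁻≗1 n)

scaledF : ℕ → ℕ
scaledF zero          = 0
scaledF (suc zero)    = 1
scaledF (suc (suc n)) = scaledF (suc n) ℕ.+ suc n ℕ.* scaledF n

[1+n]!*F[1+n] : ∀ n → ℕtoℚ (suc n !) * F (suc n) ≡ ℕtoℚ (n !) * (([1+z]· F) n + onePS n)
[1+n]!*F[1+n] n = begin
  ℕtoℚ (suc n !) * F (suc n)                 ≡⟨ cong (_* F (suc n)) (ℕtoℚ-* (suc n) (n !)) ⟩
  (ℕtoℚ (suc n) * ℕtoℚ (n !)) * F (suc n)    ≡⟨ xy∙z≈y∙xz (ℕtoℚ (suc n)) (ℕtoℚ (n !)) (F (suc n)) ⟩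
  ℕtoℚ (n !) * (∂ F) n                       ≡⟨ cong (ℕtoℚ (n !) *_) (∂F n) ⟩
  ℕtoℚ (n !) * (([1+z]· F) n + onePS n)      ∎
  where
  open ≡-Reasoning

n!*F≡scaledF : ∀ n → ℕtoℚ (n !) * F n ≡ ℕtoℚ (scaledF n)
n!*F≡scaledF zero          = refl
n!*F≡scaledF (suc zero)    = refl
n!*F≡scaledF (suc (suc n)) = begin
  ℕtoℚ (suc (suc n) !) * F (suc (suc n))
    ≡⟨ [1+n]!*F[1+n] (suc n) ⟩
  ℕtoℚ (suc n !) * ((F (suc n) + F n) + 0ℚ)
    ≡⟨ cong (_* ((F (suc n) + F n) + 0ℚ)) (ℕtoℚ-* (suc n) (n !)) ⟩
  (r * ℕtoℚ (n !)) * ((F (suc n) + F n) + 0ℚ)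
    ≡⟨ expand r (ℕtoℚ (n !)) (F (suc n)) (F n) ⟩
  (r * ℕtoℚ (n !)) * F (suc n) + r * (ℕtoℚ (n !) * F n)
    ≡⟨ cong (λ q → q * F (suc n) + r * (ℕtoℚ (n !) * F n)) (ℕtoℚ-* (suc n) (n !)) ⟨
  ℕtoℚ (suc n !) * F (suc n) + r * (ℕtoℚ (n !) * F n)
    ≡⟨ cong₂ (λ a b → a + r * b) (n!*F≡scaledF (suc n)) (n!*F≡scaledF n) ⟩
  ℕtoℚ (scaledF (suc n)) + r * ℕtoℚ (scaledF n)
    ≡⟨ cong (λ q → ℕtoℚ (scaledF (suc n)) + q) (ℕtoℚ-* (suc n) (scaledF n)) ⟨
  ℕtoℚ (scaledF (suc n)) + ℕtoℚ (suc n ℕ.* scaledF n)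
    ≡⟨ ℕtoℚ-+ (scaledF (suc n)) (suc n ℕ.* scaledF n) ⟨
  ℕtoℚ (scaledF (suc (suc n))) ∎
  where
  open ≡-Reasoning
  r = ℕtoℚ (suc n)
  expand : ∀ r m a b → (r * m) * ((a + b) + 0ℚ) ≡ (r * m) * a + r * (m * b)
  expand = solve-∀ ℚ-ring

mainTheorem8 : (n : ℕ) → ∃ λ (m : ℕ) → ℕtoℚ (n !) * F n ≡ ℕtoℚ m
mainTheorem8 n = scaledF n , n!*F≡scaledF n
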